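{- For every constant $\alpha$-formula $A$ there exists an invertible term $f\colon A\vdash I$.
   Context: Formulae are built from an infinite set of propositional letters and a constant $I$ using binary connectives $\otimes$ and $\to$. An $\alpha$-formula is a formula considered up to strict associativity of $\otimes$ and strict unitality of $I$ ($A\otimes(B\otimes C)=(A\otimes B)\otimes C$, $A\otimes I=I\otimes A=A$, also inside subformulae); it is constant if it contains no propositional letters. Terms with types $f\colon A\vdash B$: primitive $\mathbf 1_A\colon A\vdash A$, $c_{B,A}\colon B\otimes A\vdash A\otimes B$, $\eta_{A,B}\colon B\vdash A\to(A\otimes B)$, $\varepsilon_{A,B}\colon A\otimes(A\to B)\vdash B$; closed under $g\circ f$ (for $f\colon A\vdash B$, $g\colon B\vdash C$), $f_1\otimes f_2\colon A_1\otimes A_2\vdash B_1\otimes B_2$, and $A\to f\colon A\to B_1\vdash A\to B_2$ (for $f\colon B_1\vdash B_2$); strictly $f\otimes(g\otimes h)=(f\otimes g)\otimes h$, $f\otimes\mathbf 1_I=\mathbf 1_I\otimes f=f$. Equality of terms is the smallest congruence (only between terms of the same type) containing: $g\circ\mathbf 1_A=g$, $\mathbf 1_A\circ f=f$; $h\circ(g\circ f)=(h\circ g)\circ f$; $\mathbf 1_A\otimes\mathbf 1_B=\mathbf 1_{A\otimes B}$; $(g_1\otimes g_2)\circ(f_1\otimes f_2)=(g_1\circ f_1)\otimes(g_2\circ f_2)$; $c_{A',B'}\circ(f\otimes g)=(g\otimes f)\circ c_{A,B}$ ($f\colon A\vdash A'$, $g\colon B\vdash B'$); $c_{B,A}\circ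 c_{A,B}=\mathbf 1_{A\otimes B}$; $c_{A\otimes B,C}=(c_{A,C}\otimes\mathbf 1_B)\circ(\mathbf 1_A\otimes c_{B,C})$; $A\to(g\circ f)=(A\to g)\circ(A\to f)$; $\eta_{A,B'}\circ f=(A\to(\mathbf 1_A\otimes f))\circ\eta_{A,B}$ ($f\colon B\vdash B'$); $A\to\mathbf 1_B=\mathbf 1_{A\to B}$; $\varepsilon_{A,B'}\circ(\mathbf 1_A\otimes(A\to f))=f\circ\varepsilon_{A,B}$ ($f\colon B\vdash B'$); $\varepsilon_{A,A\otimes B}\circ(\mathbf 1_A\otimes\eta_{A,B})=\mathbf 1_{A\otimes B}$; $(A\to\varepsilon_{A,B})\circ\eta_{A,A\to B}=\mathbf 1_{A\to B}$. A term $f\colon A\vdash B$ is invertible if there is a term $g\colon B\vdash A$ with $g\circ f=\mathbf 1_A$ and $f\circ g=\mathbf 1_B$. -}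

module Defs where

open import Data.Nat using (ℕ)
open import Data.List using (List; []; _∷_; [_]; _++_)
open import Data.List.Relation.Unary.All using (All)
open import Data.Product using (Σ; _×_)

-- α-formulae, represented by their canonical normal forms.
-- I is the empty list and ⊗ is list concatenation, so associativity
-- and unitality of ⊗ hold (inside subformulae too) by canonicity.

data Atom : Set
Form : Set
Form = List Atom

infixr 25 _⊸_
data Atom where
  var : ℕ → Atom
  _⊸_ : Form → Form → Atom

I : Form
I = []

infixr 30 _⊗_
_⊗_ : Form → Form → Form
A ⊗ B = A ++ B

infixr 20 _⇒_
_⇒_ : Form → Form → Form
A ⇒ B = [ A ⊸ B ]

data ConstAtom : Atom → Set
ConstForm : Form → Set
ConstForm = All ConstAtom

data ConstAtom where
  imp : ∀ {A B} → ConstForm A → ConstForm B → ConstAtom (A ⊸ B)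

infixr 9 _∘ₜ_
infixr 30 _⊗ₜ_
data Term : Set where
  𝟏    : Form → Term
  c    : Form → Form → Term
  η    : Form → Form → Term
  ε    : Form → Form → Term
  _∘ₜ_ : Term → Term → Term
  _⊗ₜ_ : Term → Term → Term
  _⇒ₜ_ : Form → Term → Term

infix 4 _∶_⊢_
data _∶_⊢_ : Term → Form → Form → Set where
  𝟏 : ∀ A → 𝟏 A ∶ A ⊢ A
  c : ∀ B A → c B A ∶ B ⊗ A ⊢ A ⊗ B
  η : ∀ A B → η A B ∶ B ⊢ A ⇒ (A ⊗ B)
  ε : ∀ A B → ε A B ∶ A ⊗ (A ⇒ B) ⊢ B
  comp : ∀ {f g A B C} → f ∶ A ⊢ B → g ∶ B ⊢ C → (g ∘ₜ f) ∶ A ⊢ C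
  tens : ∀ {f₁ f₂ A₁ A₂ B₁ B₂} → f₁ ∶ A₁ ⊢ B₁ → f₂ ∶ A₂ ⊢ B₂ →
         (f₁ ⊗ₜ f₂) ∶ A₁ ⊗ A₂ ⊢ B₁ ⊗ B₂
  arr : ∀ A {f B₁ B₂} → f ∶ B₁ ⊢ B₂ → (A ⇒ₜ f) ∶ A ⇒ B₁ ⊢ A ⇒ B₂

infix 4 _≈_∶_⊢_
data _≈_∶_⊢_ : Term → Term → Form → Form → Set where
  ≈refl  : ∀ {f A B} → f ∶ A ⊢ B → f ≈ f ∶ A ⊢ B
  ≈sym   : ∀ {f g A B} → f ≈ g ∶ A ⊢ B → g ≈ f ∶ A ⊢ B
  ≈trans : ∀ {f g h A B} → f ≈ g ∶ A ⊢ B → g ≈ h ∶ A ⊢ B → f ≈ h ∶ A ⊢ B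
  ∘-cong : ∀ {f f' g g' A B C} → f ≈ f' ∶ A ⊢ B → g ≈ g' ∶ B ⊢ C →
           (g ∘ₜ f) ≈ (g' ∘ₜ f') ∶ A ⊢ C
  ⊗-cong : ∀ {f₁ f₁' f₂ f₂' A₁ A₂ B₁ B₂} →
           f₁ ≈ f₁' ∶ A₁ ⊢ B₁ → f₂ ≈ f₂' ∶ A₂ ⊢ B₂ →
           (f₁ ⊗ₜ f₂) ≈ (f₁' ⊗ₜ f₂') ∶ A₁ ⊗ A₂ ⊢ B₁ ⊗ B₂
  ⇒-cong : ∀ A {f f' B₁ B₂} → f ≈ f' ∶ B₁ ⊢ B₂ →
           (A ⇒ₜ f) ≈ (A ⇒ₜ f') ∶ A ⇒ B₁ ⊢ A ⇒ B₂
  ⊗-assoc : ∀ {f g h A₁ A₂ A₃ B₁ B₂ B₃} →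
            f ∶ A₁ ⊢ B₁ → g ∶ A₂ ⊢ B₂ → h ∶ A₃ ⊢ B₃ →
            (f ⊗ₜ (g ⊗ₜ h)) ≈ ((f ⊗ₜ g) ⊗ₜ h) ∶ A₁ ⊗ A₂ ⊗ A₃ ⊢ B₁ ⊗ B₂ ⊗ B₃
  ⊗-unitʳ : ∀ {f A B} → f ∶ A ⊢ B → (f ⊗ₜ 𝟏 I) ≈ f ∶ A ⊢ B
  ⊗-unitˡ : ∀ {f A B} → f ∶ A ⊢ B → (𝟏 I ⊗ₜ f) ≈ f ∶ A ⊢ B
  idʳ : ∀ {g A B} → g ∶ A ⊢ B → (g ∘ₜ 𝟏 A) ≈ g ∶ A ⊢ B
  idˡ : ∀ {f A B} → f ∶ A ⊢ B → (𝟏 B ∘ₜ f) ≈ f ∶ A ⊢ B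
  assoc : ∀ {f g h A B C D} → f ∶ A ⊢ B → g ∶ B ⊢ C → h ∶ C ⊢ D →
          (h ∘ₜ (g ∘ₜ f)) ≈ ((h ∘ₜ g) ∘ₜ f) ∶ A ⊢ D
  𝟏⊗𝟏 : ∀ A B → (𝟏 A ⊗ₜ 𝟏 B) ≈ 𝟏 (A ⊗ B) ∶ A ⊗ B ⊢ A ⊗ B
  interchange : ∀ {f₁ f₂ g₁ g₂ A₁ A₂ B₁ B₂ C₁ C₂} →
                f₁ ∶ A₁ ⊢ B₁ → f₂ ∶ A₂ ⊢ B₂ → g₁ ∶ B₁ ⊢ C₁ → g₂ ∶ B₂ ⊢ C₂ →
                ((g₁ ⊗ₜ g₂) ∘ₜ (f₁ ⊗ₜ f₂)) ≈ ((g₁ ∘ₜ f₁) ⊗ₜ (g₂ ∘ₜ f₂))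
                  ∶ A₁ ⊗ A₂ ⊢ C₁ ⊗ C₂
  c-nat : ∀ {f g A A' B B'} → f ∶ A ⊢ A' → g ∶ B ⊢ B' →
          (c A' B' ∘ₜ (f ⊗ₜ g)) ≈ ((g ⊗ₜ f) ∘ₜ c A B) ∶ A ⊗ B ⊢ B' ⊗ A'
  c-inv : ∀ A B → (c B A ∘ₜ c A B) ≈ 𝟏 (A ⊗ B) ∶ A ⊗ B ⊢ A ⊗ B
  c-hex : ∀ A B C → c (A ⊗ B) C ≈ ((c A C ⊗ₜ 𝟏 B) ∘ₜ (𝟏 A ⊗ₜ c B C))
                                  ∶ A ⊗ B ⊗ C ⊢ C ⊗ A ⊗ B
  ⇒-∘ : ∀ A {f g B C D} → f ∶ B ⊢ C → g ∶ C ⊢ D →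
        (A ⇒ₜ (g ∘ₜ f)) ≈ ((A ⇒ₜ g) ∘ₜ (A ⇒ₜ f)) ∶ A ⇒ B ⊢ A ⇒ D
  η-nat : ∀ A {f B B'} → f ∶ B ⊢ B' →
          (η A B' ∘ₜ f) ≈ ((A ⇒ₜ (𝟏 A ⊗ₜ f)) ∘ₜ η A B) ∶ B ⊢ A ⇒ (A ⊗ B')
  ⇒-𝟏 : ∀ A B → (A ⇒ₜ 𝟏 B) ≈ 𝟏 (A ⇒ B) ∶ A ⇒ B ⊢ A ⇒ B
  ε-nat : ∀ A {f B B'} → f ∶ B ⊢ B' →
          (ε A B' ∘ₜ (𝟏 A ⊗ₜ (A ⇒ₜ f))) ≈ (f ∘ₜ ε A B) ∶ A ⊗ (A ⇒ B) ⊢ B'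
  triangle₁ : ∀ A B → (ε A (A ⊗ B) ∘ₜ (𝟏 A ⊗ₜ η A B)) ≈ 𝟏 (A ⊗ B) ∶ A ⊗ B ⊢ A ⊗ B
  triangle₂ : ∀ A B → ((A ⇒ₜ ε A B) ∘ₜ η A (A ⇒ B)) ≈ 𝟏 (A ⇒ B) ∶ A ⇒ B ⊢ A ⇒ B

Invertible : Term → Form → Form → Set
Invertible f A B =
  Σ Term λ g → (g ∶ B ⊢ A) × ((g ∘ₜ f) ≈ 𝟏 A ∶ A ⊢ A) × ((f ∘ₜ g) ≈ 𝟏 B ∶ B ⊢ B)

{-# OPTIONS --safe #-}
-- Isomorphisms are preserved by ⊗, so
-- only A → B needs an argument, and there A ≅ I already gives A → B ≅ B:
-- one way is ε precomposed with I ≅ A, the other is the curried form of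
-- A ⊗ B ≅ B, and the two triangle laws make them mutually inverse.
module Submission where

open import Defs
open import Data.Product using (Σ; _×_; _,_)
open import Data.List using ([]; _∷_)
open import Data.List.Relation.Unary.All using ([]; _∷_)
open import Relation.Binary.Bundles using (PartialSetoid)
import Relation.Binary.Reasoning.PartialSetoid as PartialSetoidReasoning

-- Only partial: f ≈ f ∶ A ⊢ B holds just for f ∶ A ⊢ B.
hom-partialSetoid : Form → Form → PartialSetoid _ _
hom-partialSetoid A B = record
  { Carrier = Term
  ; _≈_ = λ f g → f ≈ g ∶ A ⊢ B
  ; isPartialEquivalence = record { sym = ≈sym ; trans = ≈trans }
  }

module ≈-Reasoning {A B : Form} = PartialSetoidReasoning (hom-partialSetoid A B)
open ≈-Reasoning

⊗-exchange : ∀ {f g A A' B B'} → f ∶ A ⊢ A' → g ∶ B ⊢ B' →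
  ((f ⊗ₜ 𝟏 B') ∘ₜ (𝟏 A ⊗ₜ g)) ≈ ((𝟏 A' ⊗ₜ g) ∘ₜ (f ⊗ₜ 𝟏 B)) ∶ A ⊗ B ⊢ A' ⊗ B'
⊗-exchange {f} {g} {A} {A'} {B} {B'} ⊢f ⊢g = begin
  (f ⊗ₜ 𝟏 B') ∘ₜ (𝟏 A ⊗ₜ g)   ≈⟨ interchange (𝟏 A) ⊢g ⊢f (𝟏 B') ⟩
  (f ∘ₜ 𝟏 A) ⊗ₜ (𝟏 B' ∘ₜ g)   ≈⟨ ⊗-cong (idʳ ⊢f) (idˡ ⊢g) ⟩
  f ⊗ₜ g                      ≈⟨ ⊗-cong (idˡ ⊢f) (idʳ ⊢g) ⟨
  (𝟏 A' ∘ₜ f) ⊗ₜ (g ∘ₜ 𝟏 B)   ≈⟨ interchange ⊢f (𝟏 B) (𝟏 A') ⊢g ⟨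
  (𝟏 A' ⊗ₜ g) ∘ₜ (f ⊗ₜ 𝟏 B)   ∎

curry : Form → Form → Term → Term
curry A B h = (A ⇒ₜ h) ∘ₜ η A B

curry-⊢ : ∀ {h A B C} → h ∶ A ⊗ B ⊢ C → curry A B h ∶ B ⊢ A ⇒ C
curry-⊢ {A = A} {B} ⊢h = comp (η A B) (arr A ⊢h)

curry-cong : ∀ {h h' A B C} → h ≈ h' ∶ A ⊗ B ⊢ C →
  curry A B h ≈ curry A B h' ∶ B ⊢ A ⇒ C
curry-cong {A = A} {B} h≈h' = ∘-cong (≈refl (η A B)) (⇒-cong A h≈h')

curry-∘ : ∀ {g h A B B' C} → g ∶ B ⊢ B' → h ∶ A ⊗ B' ⊢ C →
  (curry A B' h ∘ₜ g) ≈ curry A B (h ∘ₜ (𝟏 A ⊗ₜ g)) ∶ B ⊢ A ⇒ C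
curry-∘ {g} {h} {A} {B} {B'} ⊢g ⊢h = begin
  ((A ⇒ₜ h) ∘ₜ η A B') ∘ₜ g                   ≈⟨ assoc ⊢g (η A B') (arr A ⊢h) ⟨
  (A ⇒ₜ h) ∘ₜ (η A B' ∘ₜ g)                   ≈⟨ ∘-cong (η-nat A ⊢g) (≈refl (arr A ⊢h)) ⟩
  (A ⇒ₜ h) ∘ₜ ((A ⇒ₜ (𝟏 A ⊗ₜ g)) ∘ₜ η A B)    ≈⟨ assoc (η A B) (arr A ⊢1⊗g) (arr A ⊢h) ⟩
  ((A ⇒ₜ h) ∘ₜ (A ⇒ₜ (𝟏 A ⊗ₜ g))) ∘ₜ η A B    ≈⟨ ∘-cong (≈refl (η A B)) (⇒-∘ A ⊢1⊗g ⊢h) ⟨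
  (A ⇒ₜ (h ∘ₜ (𝟏 A ⊗ₜ g))) ∘ₜ η A B           ∎
  where
  ⊢1⊗g = tens (𝟏 A) ⊢g

ε∘curry : ∀ {h A B C} → h ∶ A ⊗ B ⊢ C →
  (ε A C ∘ₜ (𝟏 A ⊗ₜ curry A B h)) ≈ h ∶ A ⊗ B ⊢ C
ε∘curry {h} {A} {B} {C} ⊢h = begin
  ε A C ∘ₜ (𝟏 A ⊗ₜ ((A ⇒ₜ h) ∘ₜ η A B))
    ≈⟨ ∘-cong (≈sym split) (≈refl (ε A C)) ⟩
  ε A C ∘ₜ ((𝟏 A ⊗ₜ (A ⇒ₜ h)) ∘ₜ (𝟏 A ⊗ₜ η A B))
    ≈⟨ assoc (tens (𝟏 A) (η A B)) (tens (𝟏 A) (arr A ⊢h)) (ε A C) ⟩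
  (ε A C ∘ₜ (𝟏 A ⊗ₜ (A ⇒ₜ h))) ∘ₜ (𝟏 A ⊗ₜ η A B)
    ≈⟨ ∘-cong (≈refl (tens (𝟏 A) (η A B))) (ε-nat A ⊢h) ⟩
  (h ∘ₜ ε A (A ⊗ B)) ∘ₜ (𝟏 A ⊗ₜ η A B)
    ≈⟨ assoc (tens (𝟏 A) (η A B)) (ε A (A ⊗ B)) ⊢h ⟨
  h ∘ₜ (ε A (A ⊗ B) ∘ₜ (𝟏 A ⊗ₜ η A B))
    ≈⟨ ∘-cong (triangle₁ A B) (≈refl ⊢h) ⟩
  h ∘ₜ 𝟏 (A ⊗ B)
    ≈⟨ idʳ ⊢h ⟩
  h ∎
  where
  split : ((𝟏 A ⊗ₜ (A ⇒ₜ h)) ∘ₜ (𝟏 A ⊗ₜ η A B))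
            ≈ (𝟏 A ⊗ₜ ((A ⇒ₜ h) ∘ₜ η A B)) ∶ A ⊗ B ⊢ A ⊗ (A ⇒ C)
  split = ≈trans (interchange (𝟏 A) (η A B) (𝟏 A) (arr A ⊢h))
                 (⊗-cong (idˡ (𝟏 A)) (≈refl (curry-⊢ ⊢h)))

infix 4 _≅_
record _≅_ (A B : Form) : Set where
  field
    to from : Term
    to-⊢    : to ∶ A ⊢ B
    from-⊢  : from ∶ B ⊢ A
    from∘to : (from ∘ₜ to) ≈ 𝟏 A ∶ A ⊢ A
    to∘from : (to ∘ₜ from) ≈ 𝟏 B ∶ B ⊢ B
open _≅_

≅-refl : ∀ A → A ≅ A
≅-refl A = record
  { to = 𝟏 A ; from = 𝟏 A ; to-⊢ = 𝟏 A ; from-⊢ = 𝟏 A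
  ; from∘to = idˡ (𝟏 A) ; to∘from = idˡ (𝟏 A) }

≅-trans : ∀ {A B C} → A ≅ B → B ≅ C → A ≅ C
≅-trans {A} {B} {C} i j = record
  { to = to j ∘ₜ to i ; from = from i ∘ₜ from j
  ; to-⊢ = comp (to-⊢ i) (to-⊢ j) ; from-⊢ = comp (from-⊢ j) (from-⊢ i)
  ; from∘to = cancel (to-⊢ i) (to-⊢ j) (from-⊢ j) (from-⊢ i) (from∘to j) (from∘to i)
  ; to∘from = cancel (from-⊢ j) (from-⊢ i) (to-⊢ i) (to-⊢ j) (to∘from i) (to∘from j)
  }
  where
  cancel : ∀ {f g g' f' X Y Z} → f ∶ X ⊢ Y → g ∶ Y ⊢ Z → g' ∶ Z ⊢ Y → f' ∶ Y ⊢ X →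
    (g' ∘ₜ g) ≈ 𝟏 Y ∶ Y ⊢ Y → (f' ∘ₜ f) ≈ 𝟏 X ∶ X ⊢ X →
    ((f' ∘ₜ g') ∘ₜ (g ∘ₜ f)) ≈ 𝟏 X ∶ X ⊢ X
  cancel {f} {g} {g'} {f'} {X} {Y} ⊢f ⊢g ⊢g' ⊢f' g'g≈1 f'f≈1 = begin
    (f' ∘ₜ g') ∘ₜ (g ∘ₜ f)   ≈⟨ assoc (comp ⊢f ⊢g) ⊢g' ⊢f' ⟨
    f' ∘ₜ (g' ∘ₜ (g ∘ₜ f))   ≈⟨ ∘-cong (assoc ⊢f ⊢g ⊢g') (≈refl ⊢f') ⟩
    f' ∘ₜ ((g' ∘ₜ g) ∘ₜ f)   ≈⟨ ∘-cong (∘-cong (≈refl ⊢f) g'g≈1) (≈refl ⊢f') ⟩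
    f' ∘ₜ (𝟏 Y ∘ₜ f)         ≈⟨ ∘-cong (idˡ ⊢f) (≈refl ⊢f') ⟩
    f' ∘ₜ f                  ≈⟨ f'f≈1 ⟩
    𝟏 X                      ∎

⊗-resp-≅ : ∀ {A A' B B'} → A ≅ A' → B ≅ B' → A ⊗ B ≅ A' ⊗ B'
⊗-resp-≅ {A} {A'} {B} {B'} i j = record
  { to = to i ⊗ₜ to j ; from = from i ⊗ₜ from j
  ; to-⊢ = tens (to-⊢ i) (to-⊢ j) ; from-⊢ = tens (from-⊢ i) (from-⊢ j)
  ; from∘to = ≈trans (interchange (to-⊢ i) (to-⊢ j) (from-⊢ i) (from-⊢ j))
                     (≈trans (⊗-cong (from∘to i) (from∘to j)) (𝟏⊗𝟏 A B))
  ; to∘from = ≈trans (interchange (from-⊢ i) (from-⊢ j) (to-⊢ i) (to-⊢ j))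
                     (≈trans (⊗-cong (to∘from i) (to∘from j)) (𝟏⊗𝟏 A' B'))
  }

⇒-unitˡ-≅ : ∀ {B C} → B ≅ I → B ⇒ C ≅ C
⇒-unitˡ-≅ {B} {C} i = record
  { to = φ ; from = ψ ; to-⊢ = ⊢φ ; from-⊢ = ⊢ψ ; from∘to = ψ∘φ ; to∘from = φ∘ψ }
  where
  u = to i
  v = from i
  i⊗id : ∀ D → B ⊗ D ≅ D
  i⊗id D = ⊗-resp-≅ i (≅-refl D)

  ⊢u⊗1 : (u ⊗ₜ 𝟏 (B ⇒ C)) ∶ B ⊗ (B ⇒ C) ⊢ B ⇒ C
  ⊢u⊗1 = to-⊢ (i⊗id (B ⇒ C))
  ⊢v⊗1 : (v ⊗ₜ 𝟏 (B ⇒ C)) ∶ B ⇒ C ⊢ B ⊗ (B ⇒ C)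
  ⊢v⊗1 = from-⊢ (i⊗id (B ⇒ C))

  φ = ε B C ∘ₜ (v ⊗ₜ 𝟏 (B ⇒ C))
  ⊢φ : φ ∶ B ⇒ C ⊢ C
  ⊢φ = comp ⊢v⊗1 (ε B C)

  ψ = curry B C (u ⊗ₜ 𝟏 C)
  ⊢ψ : ψ ∶ C ⊢ B ⇒ C
  ⊢ψ = curry-⊢ (to-⊢ (i⊗id C))

  ψ∘φ : (ψ ∘ₜ φ) ≈ 𝟏 (B ⇒ C) ∶ B ⇒ C ⊢ B ⇒ C
  ψ∘φ = begin
    ψ ∘ₜ φ                                      ≈⟨ curry-∘ ⊢φ (to-⊢ (i⊗id C)) ⟩
    curry B (B ⇒ C) ((u ⊗ₜ 𝟏 C) ∘ₜ (𝟏 B ⊗ₜ φ))  ≈⟨ curry-cong u⊗1∘1⊗φ ⟩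
    curry B (B ⇒ C) (ε B C)                     ≈⟨ triangle₂ B C ⟩
    𝟏 (B ⇒ C)                                   ∎
    where
    u⊗1∘1⊗φ : ((u ⊗ₜ 𝟏 C) ∘ₜ (𝟏 B ⊗ₜ φ)) ≈ ε B C ∶ B ⊗ (B ⇒ C) ⊢ C
    u⊗1∘1⊗φ = begin
      (u ⊗ₜ 𝟏 C) ∘ₜ (𝟏 B ⊗ₜ φ)
        ≈⟨ ⊗-exchange (to-⊢ i) ⊢φ ⟩
      (𝟏 I ⊗ₜ φ) ∘ₜ (u ⊗ₜ 𝟏 (B ⇒ C))
        ≈⟨ ∘-cong (≈refl ⊢u⊗1) (⊗-unitˡ ⊢φ) ⟩
      (ε B C ∘ₜ (v ⊗ₜ 𝟏 (B ⇒ C))) ∘ₜ (u ⊗ₜ 𝟏 (B ⇒ C))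
        ≈⟨ assoc ⊢u⊗1 ⊢v⊗1 (ε B C) ⟨
      ε B C ∘ₜ ((v ⊗ₜ 𝟏 (B ⇒ C)) ∘ₜ (u ⊗ₜ 𝟏 (B ⇒ C)))
        ≈⟨ ∘-cong (from∘to (i⊗id (B ⇒ C))) (≈refl (ε B C)) ⟩
      ε B C ∘ₜ 𝟏 (B ⊗ (B ⇒ C))
        ≈⟨ idʳ (ε B C) ⟩
      ε B C ∎

  φ∘ψ : (φ ∘ₜ ψ) ≈ 𝟏 C ∶ C ⊢ C
  φ∘ψ = begin
    (ε B C ∘ₜ (v ⊗ₜ 𝟏 (B ⇒ C))) ∘ₜ ψ     ≈⟨ assoc ⊢ψ ⊢v⊗1 (ε B C) ⟨
    ε B C ∘ₜ ((v ⊗ₜ 𝟏 (B ⇒ C)) ∘ₜ ψ)     ≈⟨ ∘-cong v⊗1∘ψ (≈refl (ε B C)) ⟩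
    ε B C ∘ₜ ((𝟏 B ⊗ₜ ψ) ∘ₜ (v ⊗ₜ 𝟏 C))  ≈⟨ assoc ⊢v⊗1ᶜ (tens (𝟏 B) ⊢ψ) (ε B C) ⟩
    (ε B C ∘ₜ (𝟏 B ⊗ₜ ψ)) ∘ₜ (v ⊗ₜ 𝟏 C)  ≈⟨ ∘-cong (≈refl ⊢v⊗1ᶜ) (ε∘curry (to-⊢ (i⊗id C))) ⟩
    (u ⊗ₜ 𝟏 C) ∘ₜ (v ⊗ₜ 𝟏 C)             ≈⟨ to∘from (i⊗id C) ⟩
    𝟏 C                                  ∎
    where
    ⊢v⊗1ᶜ = from-⊢ (i⊗id C)
    v⊗1∘ψ : ((v ⊗ₜ 𝟏 (B ⇒ C)) ∘ₜ ψ) ≈ ((𝟏 B ⊗ₜ ψ) ∘ₜ (v ⊗ₜ 𝟏 C)) ∶ C ⊢ B ⊗ (B ⇒ C)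
    v⊗1∘ψ = begin
      (v ⊗ₜ 𝟏 (B ⇒ C)) ∘ₜ ψ           ≈⟨ ∘-cong (⊗-unitˡ ⊢ψ) (≈refl ⊢v⊗1) ⟨
      (v ⊗ₜ 𝟏 (B ⇒ C)) ∘ₜ (𝟏 I ⊗ₜ ψ)  ≈⟨ ⊗-exchange (from-⊢ i) ⊢ψ ⟩
      (𝟏 B ⊗ₜ ψ) ∘ₜ (v ⊗ₜ 𝟏 C)        ∎

constForm-≅-I : ∀ A → ConstForm A → A ≅ I
constAtom-≅-I : ∀ a → ConstAtom a → a ∷ [] ≅ I
constForm-≅-I [] [] = ≅-refl I
constForm-≅-I (a ∷ A) (ca ∷ cA) = ⊗-resp-≅ (constAtom-≅-I a ca) (constForm-≅-I A cA)
constAtom-≅-I (B ⊸ C) (imp cB cC) =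
  ≅-trans (⇒-unitˡ-≅ (constForm-≅-I B cB)) (constForm-≅-I C cC)

lemma4p11 : (A : Form) → ConstForm A →
    Σ Term λ f → (f ∶ A ⊢ I) × Invertible f A I
lemma4p11 A cA = to i , to-⊢ i , from i , from-⊢ i , from∘to i , to∘from i
  where i = constForm-≅-I A cA
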